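{- Let $k\ge0$ and $n\in[2^k,2^{k+1}-1)=\{2^k,\dots,2^{k+1}-2\}$, with binary expansion $\beta(n)=b_1b_2\cdots b_{k+1}$. Let $j$ be the maximum index with $b_1=\dots=b_j=1$, and define $n'$ by $\beta(n')=1\,b_{j+2}b_{j+3}\cdots b_{k+1}$. Then $$M(n)=\begin{bmatrix} q^{ -k+2j-1}h_q(n'-1) & q^{ -k+1}h_q(n-2^k-1)\\ q^{ -k+2j-2}h_q(n') & q^{ -k}h_q(n-2^k)\end{bmatrix}.$$ If $n=2^{k+1}-1$, the same formula holds with the first column replaced by $\begin{bmatrix} q^k\\ 0\end{bmatrix}$.
   Context: $h_q(n)=\sum_{\eta}q^{\ell(\eta)}$, summed over hyperbinary partitions $\eta$ of $n$ (partitions of $n$ into powers of $2$ with each part used at most twice), $\ell(\eta)$ the number of parts; $h_q(-1)=0$, $h_q(0)=1$. Binary expansions $\beta(n)=b_1\cdots b_{k+1}$ are written with $b_1=1$ the most significant digit. Let $L=\begin{bmatrix}1&0\\1&q^{ -1}\end{bmatrix}$ and $R=\begin{bmatrix}q&1\\0&1\end{bmatrix}$. For $n\ge1$ with $\beta(n)=b_1b_2\cdots b_{k+1}$, $M(n)$ is the matrix product obtained from the word $b_{k+1}b_k\cdots b_2$ (drop the leading $1$ and reverse) by replacing each $0$ by $L$ and each $1$ by $R$ (the empty product being the identity). -}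

module Defs where

open import Level using (Level)
open import Algebra.Bundles using (CommutativeRing)
open import Data.Nat using (ℕ; zero; suc; _≡ᵇ_; _%_; _/_) renaming (_+_ to _+ℕ_; _*_ to _*ℕ_)
open import Data.Nat.ListAction using (sum)
open import Data.Bool using (Bool; true; false; if_then_else_)
open import Data.List using (List; []; _∷_; map; concatMap; filter; foldr; foldl; reverse; drop)
open import Data.Integer using (ℤ; +_; -[1+_])
open import Relation.Binary.PropositionalEquality using (_≡_)
open import Data.Product using (_×_)

-- least-significant-first digits of n (fuel n suffices since n halves)
lsbBits : ℕ → ℕ → List Bool
lsbBits zero    _ = []
lsbBits (suc f) zero = []
lsbBits (suc f) (suc m) = ((suc m % 2) ≡ᵇ 1) ∷ lsbBits f (suc m / 2)

-- β(n) = b₁ b₂ ⋯ b_{k+1}, most significant digit first (b₁ = 1 for n ≥ 1)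
β : ℕ → List Bool
β n = reverse (lsbBits n n)

fromBits : List Bool → ℕ
fromBits = foldl (λ acc b → 2 *ℕ acc +ℕ (if b then 1 else 0)) 0

leadingOnes : List Bool → ℕ
leadingOnes []          = 0
leadingOnes (true ∷ bs) = suc (leadingOnes bs)
leadingOnes (false ∷ _) = 0

jIndex : ℕ → ℕ
jIndex n = leadingOnes (β n)

nPrime : ℕ → ℕ
nPrime n = fromBits (true ∷ drop (suc (jIndex n)) (β n))

-- Hyperbinary partitions ------------------------------------------------------
-- A hyperbinary partition of n is encoded by its multiplicity list
-- (m₀, m₁, …, m_n), mᵢ ∈ {0,1,2} the number of parts equal to 2^i
-- (parts 2^i with i > n cannot occur in a partition of n).

multLists : ℕ → List (List ℕ)
multLists zero    = [] ∷ []
multLists (suc m) = concatMap (λ v → map (_∷ v) (0 ∷ 1 ∷ 2 ∷ [])) (multLists m)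

partValue : List ℕ → ℕ
partValue []       = 0
partValue (m ∷ ms) = m +ℕ 2 *ℕ partValue ms

numParts : List ℕ → ℕ
numParts = sum

hyperbinary : ℕ → List (List ℕ)
hyperbinary n = filter (λ v → Data.Nat._≟_ (partValue v) n) (multLists (suc n))

module Laurent {c ℓ : Level} (R : CommutativeRing c ℓ) (q q⁻¹ : CommutativeRing.Carrier R) where
  open CommutativeRing R

  pow : Carrier → ℕ → Carrier
  pow x zero    = 1#
  pow x (suc m) = x * pow x m

  qz : ℤ → Carrier
  qz (+ m)     = pow q m
  qz -[1+ m ]  = pow q⁻¹ (suc m)

  h : ℕ → Carrier
  h n = foldr _+_ 0# (map (λ v → pow q (numParts v)) (hyperbinary n))

  -- hm1 m = h_q(m - 1), with h_q(-1) = 0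
  hm1 : ℕ → Carrier
  hm1 zero    = 0#
  hm1 (suc m) = h m

  record Mat2 : Set c where
    constructor mat
    field
      a11 a12 a21 a22 : Carrier

  _⊗_ : Mat2 → Mat2 → Mat2
  mat a b c' d ⊗ mat e f g k = mat (a * e + b * g) (a * f + b * k) (c' * e + d * g) (c' * f + d * k)

  I₂ : Mat2
  I₂ = mat 1# 0# 0# 1#

  Lm : Mat2
  Lm = mat 1# 0# 1# q⁻¹

  Rm : Mat2
  Rm = mat q 1# 0# 1#

  letter : Bool → Mat2
  letter false = Lm
  letter true  = Rm

  tail' : List Bool → List Bool
  tail' []       = []
  tail' (_ ∷ bs) = bs

  -- M(n): product over the word b_{k+1} b_k ⋯ b₂ (0 ↦ L, 1 ↦ R)
  M : ℕ → Mat2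
  M n = foldr _⊗_ I₂ (map letter (reverse (tail' (β n))))

  _≈M_ : Mat2 → Mat2 → Set ℓ
  mat a b c' d ≈M mat e f g k = (a ≈ e) × (b ≈ f) × (c' ≈ g) × (d ≈ k)

{-# OPTIONS --safe #-}
-- Write β(n) = 1w with |w| = k. M(n) is the product of the letters of w taken from the right, so
-- each column of M(n) is a column of the identity with the letters of w applied in order. Call
-- (x, y) an h-column of exponent z and index t when x = q^(z+1) h(t-1) and y = q^z h(t). L maps
-- it to the h-column of exponent z-1 and index 2t, and R to that of exponent z-1 and index 2t+1:
-- this is the content of h(2t) = h(t) + q^2 h(t-1) and h(2t+1) = q h(t), obtained by sorting
-- hyperbinary partitions by the multiplicity (0, 1 or 2) of the part 1. The second column (0, 1)
-- is the h-column with (z, t) = (0, 0), so after w it has (z, t) = (-k, n - 2^k). The first column (1, 0)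
-- stays of the form (q^i, 0) under the leading R's. When b_(j+1) = 0, the L it contributes turns
-- (q^(j-1), 0) into an h-column of index 1, and b_(j+2) ... b_(k+1) then build the index n'. When
-- there is no 0, n = 2^(k+1) - 1 and the first column is (q^k, 0).
module Submission where

open import Defs
open import Algebra.Bundles using (CommutativeRing; CommutativeSemiring)
open import Data.Bool using (Bool; true; false; if_then_else_)
open import Data.Empty using (⊥-elim)
open import Data.Integer using (ℤ; +_; -[1+_]) renaming (_+_ to _+ℤ_; _-_ to _-ℤ_; -_ to -ℤ_; _*_ to _*ℤ_)
import Data.Integer.Properties as ℤ
open import Data.Integer.Tactic.RingSolver using () renaming (solve-∀ to ℤ-solve-∀)
open import Data.List using (List; []; _∷_; _++_; _∷ʳ_; foldl; foldr; map; filter; concatMap; reverse; replicate; drop; length)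
import Data.List.Properties as List
open import Data.Nat
  using (ℕ; zero; suc; _∸_; _^_; _≤_; _<_; _≤′_; ≤′-refl; ≤′-step; z≤n; s≤s; _%_; _/_; _≡ᵇ_; _≟_)
  renaming (_+_ to _+ℕ_; _*_ to _*ℕ_)
import Data.Nat.Properties as ℕ
open import Data.Nat.DivMod using (m≡m%n+[m/n]*n; m%n<n; m/n<m; m*n/n≡m; /-monoˡ-≤; m<n*o⇒m/o<n)
open import Data.Nat.Tactic.RingSolver using (solve-∀)
open import Algebra.Properties.CommutativeSemigroup ℕ.+-commutativeSemigroup using (x∙yz≈y∙xz)
open import Data.Product using (_×_; _,_; proj₁; proj₂; Σ-syntax)
open import Function using (_∘_)
open import Relation.Binary.PropositionalEquality
  using (_≡_; _≢_; refl; sym; trans; cong; cong₂; subst; subst₂; module ≡-Reasoning)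
open import Relation.Nullary.Decidable using (does; dec-true; dec-false; yes; no)
open import Relation.Unary using (Pred; Decidable)

bit : Bool → ℕ
bit false = 0
bit true  = 1

-- Bit first, so that pushBit t false and pushBit t true are definitionally 2 * t and 1 + 2 * t.
pushBit : ℕ → Bool → ℕ
pushBit t b = bit b +ℕ 2 *ℕ t

fromBits-pushBit : ∀ w → fromBits w ≡ foldl pushBit 0 w
fromBits-pushBit = List.foldl-cong step 0
  where
  step : ∀ t b → 2 *ℕ t +ℕ (if b then 1 else 0) ≡ pushBit t b
  step t false = ℕ.+-comm (2 *ℕ t) 0
  step t true  = ℕ.+-comm (2 *ℕ t) 1

pushBit-halve : ∀ n → pushBit (n / 2) (n % 2 ≡ᵇ 1) ≡ n
pushBit-halve n with n % 2 | m%n<n n 2 | m≡m%n+[m/n]*n n 2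
... | 0           | _             | n≡ = trans (ℕ.*-comm 2 (n / 2)) (sym n≡)
... | 1           | _             | n≡ = trans (cong suc (ℕ.*-comm 2 (n / 2))) (sym n≡)
... | suc (suc _) | s≤s (s≤s ()) | _

BinaryExpansion : ℕ → ℕ → List Bool → Set
BinaryExpansion k n w = length w ≡ k × foldl pushBit 1 w ≡ n

-- The fuel f stays general so that the induction on k can pass to ⌊n/2⌋ without a fuel-irrelevance lemma.
lsbBits-expansion : ∀ k f n → n ≤ f → 2 ^ k ≤ n → n < 2 ^ suc k →
                    Σ[ w ∈ List Bool ] reverse (lsbBits f n) ≡ true ∷ w × BinaryExpansion k n w
lsbBits-expansion zero    (suc zero)    1             _ _ _ = [] , refl , refl , refl
lsbBits-expansion zero    (suc (suc f)) 1             _ _ _ = [] , refl , refl , refl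
lsbBits-expansion zero    f             (suc (suc n)) _ _ (s≤s (s≤s ()))
lsbBits-expansion (suc k) f             zero          _ lo _ = ⊥-elim (ℕ.<⇒≱ (ℕ.m^n>0 2 (suc k)) lo)
lsbBits-expansion (suc k) (suc f)       (suc n)       (s≤s n≤f) lo hi
  with lsbBits-expansion k f (suc n / 2) half≤f half-lo half-hi
  where
  half≤f : suc n / 2 ≤ f
  half≤f = ℕ.≤-trans (ℕ.≤-pred (m/n<m (suc n) 2 (s≤s (s≤s z≤n)))) n≤f
  half-lo : 2 ^ k ≤ suc n / 2
  half-lo = subst (_≤ suc n / 2) (trans (cong (_/ 2) (ℕ.*-comm 2 (2 ^ k))) (m*n/n≡m (2 ^ k) 2)) (/-monoˡ-≤ 2 lo)
  half-hi : suc n / 2 < 2 ^ suc k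
  half-hi = m<n*o⇒m/o<n (subst (suc n <_) (ℕ.*-comm 2 (2 ^ suc k)) hi)
... | w , rev≡ , len≡ , val≡ = w ∷ʳ b , rev≡′ , len≡′ , val≡′
  where
  b = suc n % 2 ≡ᵇ 1
  rev≡′ : reverse (b ∷ lsbBits f (suc n / 2)) ≡ true ∷ w ∷ʳ b
  rev≡′ = trans (List.unfold-reverse b (lsbBits f (suc n / 2))) (cong (_∷ʳ b) rev≡)
  len≡′ : length (w ∷ʳ b) ≡ suc k
  len≡′ = trans (List.length-++ w) (trans (ℕ.+-comm _ 1) (cong suc len≡))
  val≡′ : foldl pushBit 1 (w ∷ʳ b) ≡ suc n
  val≡′ = trans (List.foldl-∷ʳ pushBit 1 b w) (trans (cong (λ m → pushBit m b) val≡) (pushBit-halve (suc n)))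

β-expansion : ∀ k n → 2 ^ k ≤ n → n < 2 ^ suc k → Σ[ w ∈ List Bool ] β n ≡ true ∷ w × BinaryExpansion k n w
β-expansion k n = lsbBits-expansion k n n ℕ.≤-refl

data OnesPrefix : List Bool → Set where
  all-ones       : ∀ a → OnesPrefix (replicate a true)
  ones-then-zero : ∀ a w → OnesPrefix (replicate a true ++ false ∷ w)

onesPrefix : ∀ w → OnesPrefix w
onesPrefix []          = all-ones 0
onesPrefix (false ∷ w) = ones-then-zero 0 w
onesPrefix (true ∷ w) with onesPrefix w
... | all-ones a          = all-ones (suc a)
... | ones-then-zero a w′ = ones-then-zero (suc a) w′

leadingOnes-ones-zero : ∀ a w → leadingOnes (replicate a true ++ false ∷ w) ≡ a
leadingOnes-ones-zero zero    w = refl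
leadingOnes-ones-zero (suc a) w = cong suc (leadingOnes-ones-zero a w)

drop-ones-zero : ∀ a w → drop (suc a) (replicate a true ++ false ∷ w) ≡ w
drop-ones-zero zero    w = refl
drop-ones-zero (suc a) w = drop-ones-zero a w

length-ones-zero : ∀ a w → length (replicate a true ++ false ∷ w) ≡ a +ℕ suc (length w)
length-ones-zero a w = trans (List.length-++ (replicate a true)) (cong (_+ℕ suc (length w)) (List.length-replicate a))

2^-shift : ∀ m x → 2 ^ m *ℕ (2 *ℕ x) ≡ 2 ^ suc m *ℕ x
2^-shift m x = trans (sym (ℕ.*-assoc (2 ^ m) 2 x)) (cong (_*ℕ x) (ℕ.*-comm (2 ^ m) 2))

pushBit-< : ∀ t b → pushBit t b < 2 *ℕ suc t
pushBit-< t true  = ℕ.≤-reflexive (sym (ℕ.*-suc 2 t))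
pushBit-< t false = ℕ.≤-trans (ℕ.n≤1+n _) (pushBit-< t true)

foldl-pushBit-+ : ∀ s t w → foldl pushBit (s +ℕ t) w ≡ 2 ^ length w *ℕ s +ℕ foldl pushBit t w
foldl-pushBit-+ s t []      = cong (_+ℕ t) (sym (ℕ.*-identityˡ s))
foldl-pushBit-+ s t (b ∷ w) = begin
  foldl pushBit (pushBit (s +ℕ t) b) w        ≡⟨ cong (λ u → foldl pushBit u w) push-+ ⟩
  foldl pushBit (2 *ℕ s +ℕ pushBit t b) w     ≡⟨ foldl-pushBit-+ (2 *ℕ s) (pushBit t b) w ⟩
  2 ^ length w *ℕ (2 *ℕ s) +ℕ rest           ≡⟨ cong (_+ℕ rest) (2^-shift (length w) s) ⟩
  2 ^ suc (length w) *ℕ s +ℕ rest            ∎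
  where
  open ≡-Reasoning
  rest = foldl pushBit (pushBit t b) w
  push-+ : pushBit (s +ℕ t) b ≡ 2 *ℕ s +ℕ pushBit t b
  push-+ = trans (cong (bit b +ℕ_) (ℕ.*-distribˡ-+ 2 s t)) (x∙yz≈y∙xz (bit b) (2 *ℕ s) (2 *ℕ t))

expansion-remainder : ∀ {k n w} → BinaryExpansion k n w → foldl pushBit 0 w ≡ n ∸ 2 ^ k
expansion-remainder {k} {n} {w} (refl , val) = begin
  foldl pushBit 0 w                   ≡⟨ sym (ℕ.m+n∸m≡n (2 ^ k) _) ⟩
  2 ^ k +ℕ foldl pushBit 0 w ∸ 2 ^ k  ≡⟨ cong (λ m → m +ℕ foldl pushBit 0 w ∸ 2 ^ k) (sym (ℕ.*-identityʳ (2 ^ k))) ⟩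
  2 ^ k *ℕ 1 +ℕ foldl pushBit 0 w ∸ 2 ^ k
                                      ≡⟨ cong (_∸ 2 ^ k) (sym (foldl-pushBit-+ 1 0 w)) ⟩
  foldl pushBit 1 w ∸ 2 ^ k           ≡⟨ cong (_∸ 2 ^ k) val ⟩
  n ∸ 2 ^ k                           ∎
  where open ≡-Reasoning

foldl-pushBit-ones : ∀ a t → suc (foldl pushBit t (replicate a true)) ≡ 2 ^ a *ℕ suc t
foldl-pushBit-ones zero    t = sym (ℕ.*-identityˡ (suc t))
foldl-pushBit-ones (suc a) t = begin
  suc (foldl pushBit (pushBit t true) (replicate a true)) ≡⟨ foldl-pushBit-ones a (pushBit t true) ⟩
  2 ^ a *ℕ suc (pushBit t true)                          ≡⟨ cong (2 ^ a *ℕ_) (sym (ℕ.*-suc 2 t)) ⟩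
  2 ^ a *ℕ (2 *ℕ suc t)                                  ≡⟨ 2^-shift a (suc t) ⟩
  2 ^ suc a *ℕ suc t                                     ∎
  where open ≡-Reasoning

foldl-pushBit-< : ∀ t w → foldl pushBit t w < 2 ^ length w *ℕ suc t
foldl-pushBit-< t []      = ℕ.≤-reflexive (sym (ℕ.*-identityˡ (suc t)))
foldl-pushBit-< t (b ∷ w) = begin-strict
  foldl pushBit (pushBit t b) w      <⟨ foldl-pushBit-< (pushBit t b) w ⟩
  2 ^ length w *ℕ suc (pushBit t b)  ≤⟨ ℕ.*-monoʳ-≤ (2 ^ length w) (pushBit-< t b) ⟩
  2 ^ length w *ℕ (2 *ℕ suc t)       ≡⟨ 2^-shift (length w) (suc t) ⟩
  2 ^ suc (length w) *ℕ suc t        ∎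
  where open ℕ.≤-Reasoning

foldl-pushBit-zero-< : ∀ t w → suc (foldl pushBit t (false ∷ w)) < 2 ^ length (false ∷ w) *ℕ suc t
foldl-pushBit-zero-< t w = begin-strict
  suc (foldl pushBit (pushBit t false) w)  ≤⟨ foldl-pushBit-< (pushBit t false) w ⟩
  2 ^ length w *ℕ suc (pushBit t false)    <⟨ ℕ.*-monoʳ-< (2 ^ length w) {{ℕ.m^n≢0 2 (length w)}} (pushBit-< t true) ⟩
  2 ^ length w *ℕ (2 *ℕ suc t)             ≡⟨ 2^-shift (length w) (suc t) ⟩
  2 ^ suc (length w) *ℕ suc t              ∎
  where open ℕ.≤-Reasoning

all-ones⇒suc≡2^suc : ∀ {k n} a → BinaryExpansion k n (replicate a true) → suc n ≡ 2 ^ suc k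
all-ones⇒suc≡2^suc {k} {n} a (len , val) = begin
  suc n                                       ≡⟨ cong suc (sym val) ⟩
  suc (foldl pushBit 1 (replicate a true))    ≡⟨ foldl-pushBit-ones a 1 ⟩
  2 ^ a *ℕ 2                                  ≡⟨ ℕ.*-comm (2 ^ a) 2 ⟩
  2 ^ suc a                                   ≡⟨ cong (λ m → 2 ^ suc m) (trans (sym (List.length-replicate a)) len) ⟩
  2 ^ suc k                                   ∎
  where open ≡-Reasoning

ones-zero⇒suc<2^suc : ∀ {k n} a w → BinaryExpansion k n (replicate a true ++ false ∷ w) → suc n < 2 ^ suc k
ones-zero⇒suc<2^suc {k} {n} a w (len , val) = begin-strict
  suc n                                        ≡⟨ cong suc (trans (sym val) (List.foldl-++ pushBit 1 ones (false ∷ w))) ⟩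
  suc (foldl pushBit s (false ∷ w))            <⟨ foldl-pushBit-zero-< s w ⟩
  2 ^ suc (length w) *ℕ suc s                  ≡⟨ cong (2 ^ suc (length w) *ℕ_) (foldl-pushBit-ones a 1) ⟩
  2 ^ suc (length w) *ℕ (2 ^ a *ℕ 2)           ≡⟨ rearrange (2 ^ a) (2 ^ suc (length w)) ⟩
  2 *ℕ (2 ^ a *ℕ 2 ^ suc (length w))           ≡⟨ cong (2 *ℕ_) (sym (ℕ.^-distribˡ-+-* 2 a (suc (length w)))) ⟩
  2 ^ suc (a +ℕ suc (length w))                ≡⟨ cong (λ m → 2 ^ suc m) (trans (sym (length-ones-zero a w)) len) ⟩
  2 ^ suc k                                    ∎
  where
  open ℕ.≤-Reasoning
  ones = replicate a true
  s = foldl pushBit 1 ones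
  rearrange : ∀ x y → y *ℕ (x *ℕ 2) ≡ 2 *ℕ (x *ℕ y)
  rearrange = solve-∀

jIndex-ones-zero : ∀ {n} a w → β n ≡ true ∷ (replicate a true ++ false ∷ w) → jIndex n ≡ suc a
jIndex-ones-zero a w βn = trans (cong leadingOnes βn) (cong suc (leadingOnes-ones-zero a w))

nPrime-ones-zero : ∀ {n} a w → β n ≡ true ∷ (replicate a true ++ false ∷ w) → nPrime n ≡ foldl pushBit 1 w
nPrime-ones-zero {n} a w βn = begin
  nPrime n
    ≡⟨ cong (λ bs → fromBits (true ∷ drop (suc (leadingOnes bs)) bs)) βn ⟩
  fromBits (true ∷ drop (suc (leadingOnes ones-zero)) ones-zero)
    ≡⟨ cong (λ j → fromBits (true ∷ drop (suc j) ones-zero)) (leadingOnes-ones-zero a w) ⟩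
  fromBits (true ∷ drop (suc a) ones-zero)
    ≡⟨ cong (λ bs → fromBits (true ∷ bs)) (drop-ones-zero a w) ⟩
  fromBits (true ∷ w)
    ≡⟨ fromBits-pushBit (true ∷ w) ⟩
  foldl pushBit 1 w
    ∎
  where
  open ≡-Reasoning
  ones-zero = replicate a true ++ false ∷ w

suc≡2^suc⇒2^≤ : ∀ {k n} → suc n ≡ 2 ^ suc k → 2 ^ k ≤ n
suc≡2^suc⇒2^≤ {k} {n} eq = ℕ.≤-pred (begin
  suc (2 ^ k)  ≡⟨ ℕ.+-comm 1 (2 ^ k) ⟩
  2 ^ k +ℕ 1   ≤⟨ ℕ.+-monoʳ-≤ (2 ^ k) (ℕ.≤-trans (ℕ.m^n>0 2 k) (ℕ.m≤m+n (2 ^ k) 0)) ⟩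
  2 ^ suc k    ≡⟨ sym eq ⟩
  suc n        ∎)
  where open ℕ.≤-Reasoning

data Halving : ℕ → Set where
  zero : Halving 0
  odd  : ∀ t → Halving (1 +ℕ 2 *ℕ t)
  even : ∀ t → Halving (2 +ℕ 2 *ℕ t)

halving : ∀ n → Halving n
halving zero = zero
halving (suc n) with halving n
... | zero   = odd 0
... | odd t  = even t
... | even t = subst Halving (cong suc (ℕ.*-suc 2 t)) (odd (suc t))

module ListSum {a c ℓ} {A : Set a} (S : CommutativeSemiring c ℓ) where
  open CommutativeSemiring S renaming (refl to ≈-refl; sym to ≈-sym; trans to ≈-trans)
  open import Algebra.Properties.CommutativeSemigroup +-commutativeSemigroup using (interchange)

  ∑ : List A → (A → Carrier) → Carrier
  ∑ xs f = foldr _+_ 0# (map f xs)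

  ∑-++ : ∀ xs ys f → ∑ (xs ++ ys) f ≈ ∑ xs f + ∑ ys f
  ∑-++ []       ys f = ≈-sym (+-identityˡ _)
  ∑-++ (x ∷ xs) ys f = ≈-trans (+-congˡ (∑-++ xs ys f)) (≈-sym (+-assoc _ _ _))

  ∑-concatMap : ∀ (g : A → List A) xs f → ∑ (concatMap g xs) f ≈ ∑ xs (λ x → ∑ (g x) f)
  ∑-concatMap g []       f = ≈-refl
  ∑-concatMap g (x ∷ xs) f = ≈-trans (∑-++ (g x) (concatMap g xs) f) (+-congˡ (∑-concatMap g xs f))

  ∑-cong : ∀ xs {f g} → (∀ x → f x ≈ g x) → ∑ xs f ≈ ∑ xs g
  ∑-cong []       f≈g = ≈-refl
  ∑-cong (x ∷ xs) f≈g = +-cong (f≈g x) (∑-cong xs f≈g)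

  ∑-+ : ∀ xs f g → ∑ xs (λ x → f x + g x) ≈ ∑ xs f + ∑ xs g
  ∑-+ []       f g = ≈-sym (+-identityˡ 0#)
  ∑-+ (x ∷ xs) f g = ≈-trans (+-congˡ (∑-+ xs f g)) (interchange _ _ _ _)

  ∑-*ˡ : ∀ xs u f → ∑ xs (λ x → u * f x) ≈ u * ∑ xs f
  ∑-*ˡ []       u f = ≈-sym (zeroʳ u)
  ∑-*ˡ (x ∷ xs) u f = ≈-trans (+-congˡ (∑-*ˡ xs u f)) (≈-sym (distribˡ u _ _))

  ∑-filter : ∀ {p} {P : Pred A p} (P? : Decidable P) xs f →
             ∑ (filter P? xs) f ≈ ∑ xs (λ x → if does (P? x) then f x else 0#)
  ∑-filter P? []       f = ≈-refl
  ∑-filter P? (x ∷ xs) f with does (P? x)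
  ... | true  = +-congˡ (∑-filter P? xs f)
  ... | false = ≈-trans (∑-filter P? xs f) (≈-sym (+-identityˡ _))

module Recurrences {c ℓ} (R : CommutativeRing c ℓ) (q q⁻¹ : CommutativeRing.Carrier R) where
  open CommutativeRing R renaming (refl to ≈-refl; sym to ≈-sym; trans to ≈-trans)
  open Laurent R q q⁻¹
  open ListSum {A = List ℕ} commutativeSemiring
  open import Relation.Binary.Reasoning.Setoid setoid

  pow-+ : ∀ x m n → pow x (m +ℕ n) ≈ pow x m * pow x n
  pow-+ x zero    n = ≈-sym (*-identityˡ _)
  pow-+ x (suc m) n = ≈-trans (*-congˡ (pow-+ x m n)) (≈-sym (*-assoc _ _ _))

  weight : ℕ → List ℕ → Carrier
  weight n v = if does (partValue v ≟ n) then pow q (numParts v) else 0#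

  weight-hit : ∀ n v → partValue v ≡ n → weight n v ≡ pow q (numParts v)
  weight-hit n v eq = cong (λ b → if b then pow q (numParts v) else 0#) (dec-true (partValue v ≟ n) eq)

  weight-miss : ∀ n v → partValue v ≢ n → weight n v ≡ 0#
  weight-miss n v neq = cong (λ b → if b then pow q (numParts v) else 0#) (dec-false (partValue v ≟ n) neq)

  weight-digit : ∀ d m {n} v → d +ℕ 2 *ℕ m ≡ n → weight n (d ∷ v) ≈ pow q d * weight m v
  weight-digit d m {n} v d+2m≡n with partValue v ≟ m
  ... | yes refl = begin
    weight n (d ∷ v)                    ≡⟨ weight-hit n (d ∷ v) d+2m≡n ⟩
    pow q (d +ℕ numParts v)             ≈⟨ pow-+ q d (numParts v) ⟩
    pow q d * pow q (numParts v)        ≡⟨ cong (pow q d *_) (sym (weight-hit (partValue v) v refl)) ⟩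
    pow q d * weight (partValue v) v    ∎
  ... | no pv≢m = begin
    weight n (d ∷ v)     ≡⟨ weight-miss n (d ∷ v) (pv≢m ∘ cancel) ⟩
    0#                   ≈⟨ ≈-sym (zeroʳ _) ⟩
    pow q d * 0#         ≡⟨ cong (pow q d *_) (sym (weight-miss m v pv≢m)) ⟩
    pow q d * weight m v ∎
    where
    cancel : d +ℕ 2 *ℕ partValue v ≡ n → partValue v ≡ m
    cancel eq = ℕ.*-cancelˡ-≡ _ _ 2 (ℕ.+-cancelˡ-≡ d _ _ (trans eq (sym d+2m≡n)))

  extensions : List ℕ → List (List ℕ)
  extensions v = map (_∷ v) (0 ∷ 1 ∷ 2 ∷ [])

  -- h_q(n) computed from multiplicity lists of length L; by hDigits-stable-≤′ any L ≥ n gives h_q(n).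
  hDigits : ℕ → ℕ → Carrier
  hDigits L n = ∑ (multLists L) (weight n)

  h≈hDigits : ∀ n → h n ≈ hDigits (suc n) n
  h≈hDigits n = ∑-filter (λ v → partValue v ≟ n) (multLists (suc n)) (λ v → pow q (numParts v))

  hDigits-suc : ∀ L n → hDigits (suc L) n ≈ ∑ (multLists L) (λ v → ∑ (extensions v) (weight n))
  hDigits-suc L n = ∑-concatMap extensions (multLists L) (weight n)

  only-first : ∀ {x y z} → y ≡ 0# → z ≡ 0# → x + (y + (z + 0#)) ≈ x
  only-first refl refl = ≈-trans (+-congˡ (≈-trans (+-identityˡ _) (+-identityˡ 0#))) (+-identityʳ _)

  only-second : ∀ {x y z} → x ≡ 0# → z ≡ 0# → x + (y + (z + 0#)) ≈ y
  only-second refl refl = ≈-trans (+-identityˡ _) (≈-trans (+-congˡ (+-identityˡ 0#)) (+-identityʳ _))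

  skip-second : ∀ {x y z} → y ≡ 0# → x + (y + (z + 0#)) ≈ x + z
  skip-second refl = +-congˡ (≈-trans (+-identityˡ _) (+-identityʳ _))

  extensions-zero : ∀ v → ∑ (extensions v) (weight 0) ≈ weight 0 v
  extensions-zero v = begin
    ∑ (extensions v) (weight 0) ≈⟨ only-first (weight-miss 0 (1 ∷ v) (λ ())) (weight-miss 0 (2 ∷ v) (λ ())) ⟩
    weight 0 (0 ∷ v)            ≈⟨ weight-digit 0 0 v refl ⟩
    1# * weight 0 v             ≈⟨ *-identityˡ _ ⟩
    weight 0 v                  ∎

  extensions-odd : ∀ t v → ∑ (extensions v) (weight (1 +ℕ 2 *ℕ t)) ≈ q * weight t v
  extensions-odd t v = begin
    ∑ (extensions v) (weight n)
      ≈⟨ only-second (weight-miss n (0 ∷ v) (ℕ.even≢odd (partValue v) t))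
                     (weight-miss n (2 ∷ v) (ℕ.even≢odd t (partValue v) ∘ sym ∘ ℕ.suc-injective)) ⟩
    weight n (1 ∷ v)    ≈⟨ weight-digit 1 t v refl ⟩
    q * 1# * weight t v ≈⟨ *-congʳ (*-identityʳ q) ⟩
    q * weight t v      ∎
    where n = 1 +ℕ 2 *ℕ t

  extensions-even : ∀ t v → ∑ (extensions v) (weight (2 +ℕ 2 *ℕ t)) ≈ weight (suc t) v + q * q * weight t v
  extensions-even t v = begin
    ∑ (extensions v) (weight n)
      ≈⟨ skip-second (weight-miss n (1 ∷ v) (ℕ.even≢odd (partValue v) t ∘ ℕ.suc-injective)) ⟩
    weight n (0 ∷ v) + weight n (2 ∷ v)
      ≈⟨ +-cong (weight-digit 0 (suc t) v (ℕ.*-suc 2 t)) (weight-digit 2 t v refl) ⟩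
    1# * weight (suc t) v + q * (q * 1#) * weight t v
      ≈⟨ +-cong (*-identityˡ _) (*-congʳ (*-congˡ (*-identityʳ q))) ⟩
    weight (suc t) v + q * q * weight t v ∎
    where n = 2 +ℕ 2 *ℕ t

  hDigits-zero : ∀ L → hDigits (suc L) 0 ≈ hDigits L 0
  hDigits-zero L = ≈-trans (hDigits-suc L 0) (∑-cong (multLists L) extensions-zero)

  hDigits-odd : ∀ L t → hDigits (suc L) (1 +ℕ 2 *ℕ t) ≈ q * hDigits L t
  hDigits-odd L t = begin
    hDigits (suc L) (1 +ℕ 2 *ℕ t)                   ≈⟨ hDigits-suc L _ ⟩
    ∑ (multLists L) (λ v → ∑ (extensions v) (weight (1 +ℕ 2 *ℕ t))) ≈⟨ ∑-cong (multLists L) (extensions-odd t) ⟩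
    ∑ (multLists L) (λ v → q * weight t v)          ≈⟨ ∑-*ˡ (multLists L) q (weight t) ⟩
    q * hDigits L t                                 ∎

  hDigits-even : ∀ L t → hDigits (suc L) (2 +ℕ 2 *ℕ t) ≈ hDigits L (suc t) + q * q * hDigits L t
  hDigits-even L t = begin
    hDigits (suc L) (2 +ℕ 2 *ℕ t)                   ≈⟨ hDigits-suc L _ ⟩
    ∑ (multLists L) (λ v → ∑ (extensions v) (weight (2 +ℕ 2 *ℕ t))) ≈⟨ ∑-cong (multLists L) (extensions-even t) ⟩
    ∑ (multLists L) (λ v → weight (suc t) v + q * q * weight t v)  ≈⟨ ∑-+ (multLists L) (weight (suc t)) _ ⟩
    hDigits L (suc t) + ∑ (multLists L) (λ v → q * q * weight t v) ≈⟨ +-congˡ (∑-*ˡ (multLists L) (q * q) (weight t)) ⟩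
    hDigits L (suc t) + q * q * hDigits L t        ∎

  hDigits-stable : ∀ L {n} → Halving n → n ≤ L → hDigits (suc L) n ≈ hDigits L n
  hDigits-stable L       zero     _             = hDigits-zero L
  hDigits-stable (suc L) (odd t)  (s≤s 2t≤L)    = begin
    hDigits (suc (suc L)) (1 +ℕ 2 *ℕ t) ≈⟨ hDigits-odd (suc L) t ⟩
    q * hDigits (suc L) t              ≈⟨ *-congˡ (hDigits-stable L (halving t) (ℕ.≤-trans (ℕ.m≤m+n t _) 2t≤L)) ⟩
    q * hDigits L t                    ≈⟨ ≈-sym (hDigits-odd L t) ⟩
    hDigits (suc L) (1 +ℕ 2 *ℕ t)       ∎
  hDigits-stable (suc L) (even t) (s≤s 1+2t≤L)  = begin
    hDigits (suc (suc L)) (2 +ℕ 2 *ℕ t)                       ≈⟨ hDigits-even (suc L) t ⟩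
    hDigits (suc L) (suc t) + q * q * hDigits (suc L) t
      ≈⟨ +-cong (hDigits-stable L (halving (suc t)) 1+t≤L)
                (*-congˡ (hDigits-stable L (halving t) (ℕ.≤-trans (ℕ.n≤1+n t) 1+t≤L))) ⟩
    hDigits L (suc t) + q * q * hDigits L t                  ≈⟨ ≈-sym (hDigits-even L t) ⟩
    hDigits (suc L) (2 +ℕ 2 *ℕ t)                             ∎
    where
    1+t≤L : suc t ≤ L
    1+t≤L = ℕ.≤-trans (s≤s (ℕ.m≤m+n t _)) 1+2t≤L

  hDigits-stable-≤′ : ∀ {L L′ n} → n ≤ L → L ≤′ L′ → hDigits L′ n ≈ hDigits L n
  hDigits-stable-≤′ n≤L ≤′-refl = ≈-refl
  hDigits-stable-≤′ {n = n} n≤L (≤′-step {L′} L≤′L′) =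
    ≈-trans (hDigits-stable L′ (halving n) (ℕ.≤-trans n≤L (ℕ.≤′⇒≤ L≤′L′)))
            (hDigits-stable-≤′ n≤L L≤′L′)

  h-zero : h 0 ≈ 1#
  h-zero = +-identityʳ 1#

  h-odd : ∀ t → h (1 +ℕ 2 *ℕ t) ≈ q * h t
  h-odd t = begin
    h (1 +ℕ 2 *ℕ t)                    ≈⟨ h≈hDigits (1 +ℕ 2 *ℕ t) ⟩
    hDigits (2 +ℕ 2 *ℕ t) (1 +ℕ 2 *ℕ t) ≈⟨ hDigits-odd (1 +ℕ 2 *ℕ t) t ⟩
    q * hDigits (1 +ℕ 2 *ℕ t) t
      ≈⟨ *-congˡ (hDigits-stable-≤′ (ℕ.n≤1+n t) (ℕ.≤⇒≤′ (s≤s (ℕ.m≤m+n t (t +ℕ 0))))) ⟩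
    q * hDigits (suc t) t               ≈⟨ *-congˡ (≈-sym (h≈hDigits t)) ⟩
    q * h t                             ∎

  h-even : ∀ t → h (2 +ℕ 2 *ℕ t) ≈ h (suc t) + q * q * h t
  h-even t = begin
    h (2 +ℕ 2 *ℕ t)                                               ≈⟨ h≈hDigits (2 +ℕ 2 *ℕ t) ⟩
    hDigits (3 +ℕ 2 *ℕ t) (2 +ℕ 2 *ℕ t)                            ≈⟨ hDigits-even (2 +ℕ 2 *ℕ t) t ⟩
    hDigits (2 +ℕ 2 *ℕ t) (suc t) + q * q * hDigits (2 +ℕ 2 *ℕ t) t
      ≈⟨ +-cong (hDigits-stable-≤′ (ℕ.n≤1+n (suc t)) (ℕ.≤⇒≤′ (s≤s (s≤s (ℕ.m≤m+n t (t +ℕ 0))))))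
                (*-congˡ (hDigits-stable-≤′ (ℕ.n≤1+n t) (ℕ.≤⇒≤′ (s≤s (ℕ.≤-trans (ℕ.m≤m+n t (t +ℕ 0)) (ℕ.n≤1+n _)))))) ⟩
    hDigits (2 +ℕ t) (suc t) + q * q * hDigits (suc t) t
      ≈⟨ ≈-sym (+-cong (h≈hDigits (suc t)) (*-congˡ (h≈hDigits t))) ⟩
    h (suc t) + q * q * h t                                       ∎

  hm1-double : ∀ t → hm1 (2 *ℕ t) ≈ q * hm1 t
  hm1-double zero    = ≈-sym (zeroʳ q)
  hm1-double (suc t) = ≈-trans (reflexive (cong hm1 (ℕ.*-suc 2 t))) (h-odd t)

  h-double : ∀ t → h (2 *ℕ t) ≈ h t + q * q * hm1 t
  h-double zero    = ≈-sym (≈-trans (+-congˡ (zeroʳ _)) (+-identityʳ _))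
  h-double (suc t) = ≈-trans (reflexive (cong h (ℕ.*-suc 2 t))) (h-even t)

col₁-exponent : ∀ a p → (-ℤ + (a +ℕ suc p) +ℤ + (2 *ℕ suc a) -ℤ + 2 +ℤ + p) +ℤ + 1 ≡ + a
col₁-exponent a p = trans (cong₂ (λ x y → (-ℤ x +ℤ y -ℤ + 2 +ℤ + p) +ℤ + 1) (ℤ.pos-+ a (suc p)) (ℤ.pos-* 2 (suc a)))
                              (linear (+ a) (+ p))
  where
  linear : ∀ x y → (-ℤ (x +ℤ (+ 1 +ℤ y)) +ℤ + 2 *ℤ (+ 1 +ℤ x) -ℤ + 2 +ℤ y) +ℤ + 1 ≡ x
  linear = ℤ-solve-∀

module Columns {c ℓ} (R : CommutativeRing c ℓ) (q q⁻¹ : CommutativeRing.Carrier R)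
               (qq⁻¹≈1 : CommutativeRing._≈_ R (CommutativeRing._*_ R q q⁻¹) (CommutativeRing.1# R)) where
  open CommutativeRing R renaming (refl to ≈-refl; sym to ≈-sym; trans to ≈-trans)
  open Laurent R q q⁻¹
  open Recurrences R q q⁻¹
  open import Relation.Binary.Reasoning.Setoid setoid
  open import Algebra.Solver.Ring.NaturalCoefficients.Default commutativeSemiring using (solve; _:+_; _:*_; _:=_)

  q[q⁻¹x]≈x : ∀ x → q * (q⁻¹ * x) ≈ x
  q[q⁻¹x]≈x x = ≈-trans (≈-sym (*-assoc q q⁻¹ x)) (≈-trans (*-congʳ qq⁻¹≈1) (*-identityˡ x))

  q⁻¹[qx]≈x : ∀ x → q⁻¹ * (q * x) ≈ x
  q⁻¹[qx]≈x x = ≈-trans (≈-sym (*-assoc q⁻¹ q x)) (≈-trans (*-congʳ q⁻¹q≈1) (*-identityˡ x))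
    where q⁻¹q≈1 = ≈-trans (*-comm q⁻¹ q) qq⁻¹≈1

  qz-suc : ∀ z → qz (z +ℤ + 1) ≈ q * qz z
  qz-suc (+ m)          = reflexive (cong (pow q) (ℕ.+-comm m 1))
  qz-suc -[1+ zero ]    = ≈-sym (q[q⁻¹x]≈x 1#)
  qz-suc -[1+ suc m ]   = ≈-sym (q[q⁻¹x]≈x _)

  _·_ : Mat2 → Carrier × Carrier → Carrier × Carrier
  mat a₁₁ a₁₂ a₂₁ a₂₂ · (x , y) = a₁₁ * x + a₁₂ * y , a₂₁ * x + a₂₂ * y

  col₁ col₂ : Mat2 → Carrier × Carrier
  col₁ (mat a₁₁ _ a₂₁ _) = a₁₁ , a₂₁
  col₂ (mat _ a₁₂ _ a₂₂) = a₁₂ , a₂₂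

  foldr-⊗-columns : ∀ As B → col₁ (foldr _⊗_ B As) ≡ foldr _·_ (col₁ B) As
                           × col₂ (foldr _⊗_ B As) ≡ foldr _·_ (col₂ B) As
  foldr-⊗-columns []       B = refl , refl
  foldr-⊗-columns (A ∷ As) B with foldr-⊗-columns As B
  ... | c₁ , c₂ = cong (A ·_) c₁ , cong (A ·_) c₂

  run : List Bool → Carrier × Carrier → Carrier × Carrier
  run w v = foldl (λ u b → letter b · u) v w

  M-columns : ∀ {n w} → β n ≡ true ∷ w → col₁ (M n) ≡ run w (1# , 0#) × col₂ (M n) ≡ run w (0# , 1#)
  M-columns {n} {w} βn with foldr-⊗-columns (map letter (reverse w)) I₂
  ... | c₁ , c₂ = trans (cong col₁ M≡) (trans c₁ (word (1# , 0#))) , trans (cong col₂ M≡) (trans c₂ (word (0# , 1#)))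
    where
    M≡ : M n ≡ foldr _⊗_ I₂ (map letter (reverse w))
    M≡ = cong (λ bs → foldr _⊗_ I₂ (map letter (reverse (tail' bs)))) βn
    word : ∀ v → foldr _·_ v (map letter (reverse w)) ≡ run w v
    word v = trans (List.foldr-map _·_ letter v (reverse w)) (List.reverse-foldr _ v w)

  record HColumn (z : ℤ) (t : ℕ) (v : Carrier × Carrier) : Set ℓ where
    constructor hcol
    field
      upper : proj₁ v ≈ qz (z +ℤ + 1) * hm1 t
      lower : proj₂ v ≈ qz z * h t

  record PowerColumn (m : ℕ) (v : Carrier × Carrier) : Set ℓ where
    constructor powcol
    field
      upper : proj₁ v ≈ pow q m
      lower : proj₂ v ≈ 0#

  1x+0y≈x : ∀ x y → 1# * x + 0# * y ≈ x
  1x+0y≈x x y = ≈-trans (+-cong (*-identityˡ x) (zeroˡ y)) (+-identityʳ x)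

  0x+1y≈y : ∀ x y → 0# * x + 1# * y ≈ y
  0x+1y≈y x y = ≈-trans (+-cong (zeroˡ x) (*-identityˡ y)) (+-identityˡ y)

  HColumn-step : ∀ b {z t} v → HColumn (z +ℤ + 1) t v → HColumn z (pushBit t b) (letter b · v)
  HColumn-step b {z} {t} (x , y) (hcol x≈ y≈) = step b
    where
    Z = qz z
    x≈′ : x ≈ q * (q * Z) * hm1 t
    x≈′ = ≈-trans x≈ (*-congʳ (≈-trans (qz-suc (z +ℤ + 1)) (*-congˡ (qz-suc z))))
    y≈′ : y ≈ q * Z * h t
    y≈′ = ≈-trans y≈ (*-congʳ (qz-suc z))
    step : ∀ b → HColumn z (pushBit t b) (letter b · (x , y))
    step false = hcol (begin
      1# * x + 0# * y                   ≈⟨ ≈-trans (1x+0y≈x x y) x≈′ ⟩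
      q * (q * Z) * hm1 t               ≈⟨ solve 3 (λ q Z H → q :* (q :* Z) :* H := q :* Z :* (q :* H)) ≈-refl q Z (hm1 t) ⟩
      q * Z * (q * hm1 t)               ≈⟨ *-cong (≈-sym (qz-suc z)) (≈-sym (hm1-double t)) ⟩
      qz (z +ℤ + 1) * hm1 (2 *ℕ t)      ∎) (begin
      1# * x + q⁻¹ * y
        ≈⟨ +-cong (≈-trans (*-identityˡ x) x≈′) (*-congˡ (≈-trans y≈′ (*-assoc q Z (h t)))) ⟩
      q * (q * Z) * hm1 t + q⁻¹ * (q * (Z * h t))
        ≈⟨ +-congˡ (q⁻¹[qx]≈x (Z * h t)) ⟩
      q * (q * Z) * hm1 t + Z * h t
        ≈⟨ solve 4 (λ q Z H K → q :* (q :* Z) :* H :+ Z :* K := Z :* (K :+ q :* q :* H)) ≈-refl q Z (hm1 t) (h t) ⟩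
      Z * (h t + q * q * hm1 t)         ≈⟨ *-congˡ (≈-sym (h-double t)) ⟩
      Z * h (2 *ℕ t)                    ∎)
    step true = hcol (begin
      q * x + 1# * y                    ≈⟨ +-cong (*-congˡ x≈′) (≈-trans (*-identityˡ y) y≈′) ⟩
      q * (q * (q * Z) * hm1 t) + q * Z * h t
        ≈⟨ solve 4 (λ q Z H K → q :* (q :* (q :* Z) :* H) :+ q :* Z :* K := q :* Z :* (K :+ q :* q :* H))
                 ≈-refl q Z (hm1 t) (h t) ⟩
      q * Z * (h t + q * q * hm1 t)     ≈⟨ *-cong (≈-sym (qz-suc z)) (≈-sym (h-double t)) ⟩
      qz (z +ℤ + 1) * h (2 *ℕ t)        ∎) (begin
      0# * x + 1# * y                   ≈⟨ ≈-trans (0x+1y≈y x y) y≈′ ⟩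
      q * Z * h t                       ≈⟨ solve 3 (λ q Z K → q :* Z :* K := Z :* (q :* K)) ≈-refl q Z (h t) ⟩
      Z * (q * h t)                     ≈⟨ *-congˡ (≈-sym (h-odd t)) ⟩
      Z * h (1 +ℕ 2 *ℕ t)               ∎)

  HColumn-run : ∀ w {z t v} → HColumn (z +ℤ + length w) t v → HColumn z (foldl pushBit t w) (run w v)
  HColumn-run []      {z} {t} {v} hc = subst (λ z′ → HColumn z′ t v) (ℤ.+-identityʳ z) hc
  HColumn-run (b ∷ w) {z} {t} {v} hc = HColumn-run w (HColumn-step b v (subst (λ z′ → HColumn z′ t v) shift hc))
    where
    shift : z +ℤ + suc (length w) ≡ z +ℤ + length w +ℤ + 1
    shift = trans (cong (λ m → z +ℤ + m) (ℕ.+-comm 1 (length w))) (sym (ℤ.+-assoc z (+ length w) (+ 1)))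

  PowerColumn-R : ∀ {m} v → PowerColumn m v → PowerColumn (suc m) (Rm · v)
  PowerColumn-R (x , y) (powcol x≈ y≈) = powcol
    (≈-trans (+-cong (*-congˡ x≈) (≈-trans (*-congˡ y≈) (zeroʳ 1#))) (+-identityʳ _))
    (≈-trans (0x+1y≈y x y) y≈)

  PowerColumn-run-ones : ∀ a {m} v → PowerColumn m v → PowerColumn (m +ℕ a) (run (replicate a true) v)
  PowerColumn-run-ones zero    {m} v pc = subst (λ k → PowerColumn k v) (sym (ℕ.+-identityʳ m)) pc
  PowerColumn-run-ones (suc a) {m} v pc =
    subst (λ k → PowerColumn k (run (replicate a true) (Rm · v))) (sym (ℕ.+-suc m a))
          (PowerColumn-run-ones a (Rm · v) (PowerColumn-R v pc))

  run-ones-e₁ : ∀ a → PowerColumn a (run (replicate a true) (1# , 0#))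
  run-ones-e₁ a = PowerColumn-run-ones a (1# , 0#) (powcol ≈-refl ≈-refl)

  PowerColumn-L : ∀ {m z} v → z +ℤ + 1 ≡ + m → PowerColumn m v → HColumn z 1 (Lm · v)
  PowerColumn-L {m} {z} (x , y) z+1≡m (powcol x≈ y≈) = hcol (begin
    1# * x + 0# * y         ≈⟨ ≈-trans (1x+0y≈x x y) x≈ ⟩
    pow q m                 ≡⟨ cong qz (sym z+1≡m) ⟩
    qz (z +ℤ + 1)           ≈⟨ ≈-sym (≈-trans (*-congˡ h-zero) (*-identityʳ _)) ⟩
    qz (z +ℤ + 1) * h 0     ∎) (begin
    1# * x + q⁻¹ * y        ≈⟨ +-cong (≈-trans (*-identityˡ x) x≈) (≈-trans (*-congˡ y≈) (zeroʳ q⁻¹)) ⟩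
    pow q m + 0#            ≈⟨ +-identityʳ _ ⟩
    pow q m                 ≡⟨ cong qz (sym z+1≡m) ⟩
    qz (z +ℤ + 1)           ≈⟨ ≈-trans (qz-suc z) (*-comm q (qz z)) ⟩
    qz z * q                ≈⟨ *-congˡ (≈-sym (≈-trans (*-congˡ h-zero) (*-identityʳ q))) ⟩
    qz z * (q * h 0)        ≈⟨ *-congˡ (≈-sym (h-odd 0)) ⟩
    qz z * h 1              ∎)

  M-col₂ : ∀ {k n w} → β n ≡ true ∷ w → BinaryExpansion k n w → HColumn (-ℤ + k) (n ∸ 2 ^ k) (col₂ (M n))
  M-col₂ {n = n} {w} βn exp@(refl , _) =
    subst₂ (HColumn (-ℤ + length w)) (expansion-remainder {w = w} exp) (sym (proj₂ (M-columns {n} βn)))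
           (HColumn-run w initial)
    where
    initial : HColumn (-ℤ + length w +ℤ + length w) 0 (0# , 1#)
    initial = subst (λ z → HColumn z 0 (0# , 1#)) (sym (ℤ.+-inverseˡ (+ length w)))
                  (hcol (≈-sym (zeroʳ _)) (≈-sym (≈-trans (*-identityˡ _) h-zero)))

  M-col₁-ones : ∀ {n} a → β n ≡ true ∷ replicate a true → PowerColumn a (col₁ (M n))
  M-col₁-ones {n} a βn = subst (PowerColumn a) (sym (proj₁ (M-columns {n} βn))) (run-ones-e₁ a)

  M-col₁-ones-zero : ∀ {n z} a w → β n ≡ true ∷ (replicate a true ++ false ∷ w) →
                           z +ℤ + length w +ℤ + 1 ≡ + a → HColumn z (foldl pushBit 1 w) (col₁ (M n))
  M-col₁-ones-zero {n} {z} a w βn z≡ =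
    subst (HColumn z (foldl pushBit 1 w)) (sym col₁≡) (HColumn-run w (PowerColumn-L _ z≡ (run-ones-e₁ a)))
    where
    col₁≡ : col₁ (M n) ≡ run w (Lm · run (replicate a true) (1# , 0#))
    col₁≡ = trans (proj₁ (M-columns {n} βn)) (List.foldl-++ _ (1# , 0#) (replicate a true) (false ∷ w))

  M-col₁ : ∀ {k n} a w → β n ≡ true ∷ (replicate a true ++ false ∷ w) →
                 BinaryExpansion k n (replicate a true ++ false ∷ w) →
                 HColumn (-ℤ (+ k) +ℤ + (2 *ℕ jIndex n) -ℤ + 2) (nPrime n) (col₁ (M n))
  M-col₁ {k} {n} a w βn (len , _) =
    subst₂ (λ z t → HColumn z t (col₁ (M n))) (cong₂ exponent k≡ j≡) n′≡
           (M-col₁-ones-zero {n} {exponent (a +ℕ suc (length w)) (suc a)} a w βn (col₁-exponent a (length w)))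
    where
    exponent : ℕ → ℕ → ℤ
    exponent k j = -ℤ (+ k) +ℤ + (2 *ℕ j) -ℤ + 2
    k≡ : a +ℕ suc (length w) ≡ k
    k≡ = trans (sym (length-ones-zero a w)) len
    j≡ : suc a ≡ jIndex n
    j≡ = sym (jIndex-ones-zero {n} a w βn)
    n′≡ : foldl pushBit 1 w ≡ nPrime n
    n′≡ = sym (nPrime-ones-zero {n} a w βn)

  M-formula : ∀ k n → 2 ^ k ≤ n → suc n < 2 ^ suc k →
    M n ≈M mat (qz (-ℤ (+ k) +ℤ + (2 *ℕ jIndex n) -ℤ + 1) * hm1 (nPrime n))
               (qz (-ℤ (+ k) +ℤ + 1) * hm1 (n ∸ 2 ^ k))
               (qz (-ℤ (+ k) +ℤ + (2 *ℕ jIndex n) -ℤ + 2) * h (nPrime n))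
               (qz (-ℤ (+ k)) * h (n ∸ 2 ^ k))
  M-formula k n lo hi with β-expansion k n lo (ℕ.<-trans (ℕ.n<1+n n) hi)
  ... | w , βn , exp with onesPrefix w
  ... | all-ones a          = ⊥-elim (ℕ.<-irrefl (all-ones⇒suc≡2^suc a exp) hi)
  ... | ones-then-zero a w′ with M-col₁ {n = n} a w′ βn exp | M-col₂ {n = n} βn exp
  ... | hcol x₁ y₁ | hcol x₂ y₂ =
    ≈-trans x₁ (*-congʳ (reflexive (cong qz (x-2+1≡x-1 (-ℤ (+ k) +ℤ + (2 *ℕ jIndex n)))))) , x₂ , y₁ , y₂
    where
    x-2+1≡x-1 : ∀ x → x -ℤ + 2 +ℤ + 1 ≡ x -ℤ + 1
    x-2+1≡x-1 = ℤ-solve-∀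

  M-formula-mersenne : ∀ k n → suc n ≡ 2 ^ suc k →
    M n ≈M mat (qz (+ k)) (qz (-ℤ (+ k) +ℤ + 1) * hm1 (n ∸ 2 ^ k)) 0# (qz (-ℤ (+ k)) * h (n ∸ 2 ^ k))
  M-formula-mersenne k n eq with β-expansion k n (suc≡2^suc⇒2^≤ {k} eq) (ℕ.≤-reflexive eq)
  ... | w , βn , exp with onesPrefix w
  ... | ones-then-zero a w′ = ⊥-elim (ℕ.<-irrefl eq (ones-zero⇒suc<2^suc a w′ exp))
  ... | all-ones a with M-col₁-ones {n} a βn | M-col₂ {n = n} βn exp
  ... | powcol x₁ y₁ | hcol x₂ y₂ = ≈-trans x₁ (reflexive (cong (pow q) a≡k)) , x₂ , y₁ , y₂
    where
    a≡k : a ≡ k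
    a≡k = trans (sym (List.length-replicate a)) (proj₁ exp)

theorem4p2 : ∀ {c ℓ} (R : CommutativeRing c ℓ) (q q⁻¹ : CommutativeRing.Carrier R) →
    CommutativeRing._≈_ R (CommutativeRing._*_ R q q⁻¹) (CommutativeRing.1# R) →
    let open CommutativeRing R in
    let open Laurent R q q⁻¹ in
    (k n : ℕ) →
    ((2 ^ k ≤ n) → (suc n < 2 ^ suc k) →
      M n ≈M mat (qz (-ℤ (+ k) +ℤ + (2 *ℕ jIndex n) -ℤ + 1) * hm1 (nPrime n))
                 (qz (-ℤ (+ k) +ℤ + 1) * hm1 (n ∸ 2 ^ k))
                 (qz (-ℤ (+ k) +ℤ + (2 *ℕ jIndex n) -ℤ + 2) * h (nPrime n))
                 (qz (-ℤ (+ k)) * h (n ∸ 2 ^ k)))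
    × ((suc n ≡ 2 ^ suc k) →
      M n ≈M mat (qz (+ k))
                 (qz (-ℤ (+ k) +ℤ + 1) * hm1 (n ∸ 2 ^ k))
                 0#
                 (qz (-ℤ (+ k)) * h (n ∸ 2 ^ k)))
theorem4p2 R q q⁻¹ qq⁻¹≈1 k n = M-formula k n , M-formula-mersenne k n
  where open Columns R q q⁻¹ qq⁻¹≈1
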